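{- Let $d\ge1$ and let $T=([n],\epsilon)$ be a $d$-tournament. If for every vertex $1\le i\le n$ the $(d-1)$-tournament $lk_T(i)$ is acyclic, then $T$ is acyclic. Moreover, the same conclusion holds even if one only assumes that for every $1\le i\le n$ the restriction of $lk_T(i)$ to the vertex set $\{i+1,i+2,\ldots,n\}$ is acyclic.
   Context: Let $W$ be a finite totally ordered set (e.g. a subset of $[n]$ with the induced order) and $m\ge 0$ an integer. An $m$-tournament on $W$ is a map $\epsilon:\binom{W}{m+1}\to\{ -1,1\}$, $\sigma\mapsto \epsilon_\sigma$; the elements of $\binom{W}{m+1}$ are called $m$-faces. For an $m$-face $\sigma=\{i_0<\dots<i_m\}$ and $\tau=\sigma\setminus\{i_j\}$ put $(\tau;\sigma)=(-1)^{m-j}$, and $(\tau;\sigma)=0$ if $\tau\not\subset\sigma$. The incidence matrix $A$ has rows indexed by $m$-element subsets $\tau$ of $W$, columns indexed by $(m+1)$-element subsets $\sigma$, and entries $A_{\tau,\sigma}=\epsilon_\sigma(\tau;\sigma)$. A nonempty set $C$ of $m$-faces is a cycle if there are positive reals $v_F$ ($F\in C$) with $\sum_{F\in C}v_FA_{*,F}=0$ ($A_{*,F}$ the column of $F$); the tournament is acyclic if it has no cycle. The restriction of a tournament on $W$ to a subset $U\subseteq W$ is the tournament on $U$ (with induced order) keeping the orientations $\epsilon_\sigma$ of all faces $\sigma\subseteq U$. For a $d$-tournament $T=([n],\epsilon)$ and a vertex $x$, the link $lk_T(x)$ is the $(d-1)$-tournament on $[n]\setminus\{x\}$ assigning to each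 $(d-1)$-face $\tau$ the orientation $\epsilon_{\tau\cup\{x\}}\cdot(\tau;\tau\cup\{x\})$.
   Formalization: The weights $v_F$ of a cycle are taken in the positive rationals instead of the positive reals, so this applies to acyclicity of the links $lk_T(i)$, of their restrictions and of T. -}

module Defs where

open import Data.Nat as ℕ using (ℕ; zero; suc; _∸_)
open import Data.Fin using (Fin; _<_; _<?_)
open import Data.Fin.Subset using (Subset; _∈_; _∉_; _⊆_; _∪_; _─_; ⁅_⁆; ∣_∣; ⊤)
open import Data.Fin.Subset.Properties using (_∈?_)
open import Data.Integer as ℤ using (ℤ)
open import Data.Rational as ℚ using (ℚ; 0ℚ)
open import Data.Sign as Sign using (Sign)
open import Data.Bool.Properties using () renaming (_≟_ to _≟ᵇ_)
open import Data.Vec.Properties using (≡-dec)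
open import Data.Vec using (tabulate)
open import Data.List using (List; []; foldr; map; filter; length; allFin)
open import Data.List.Relation.Unary.All using (All)
open import Data.List.Relation.Unary.Unique.Propositional using (Unique)
open import Data.Product using (Σ; _×_)
open import Relation.Nullary using (does; ¬_; Dec; yes; no; _×-dec_)
open import Relation.Binary.PropositionalEquality using (_≡_; _≢_)

-- An m-tournament on W is given by an orientation ε_σ ∈ {-1,1} (a Sign) for each
-- m-face σ ⊆ W; we model it as a function on all subsets, whose values on
-- non-faces are irrelevant.
Orientation : ℕ → Set
Orientation n = Subset n → Sign

signPow : ℕ → Sign
signPow zero    = Sign.+
signPow (suc k) = Sign.opposite (signPow k)

index : ∀ {n} → Subset n → Fin n → ℕ
index σ x = length (filter (λ y → (y ∈? σ) ×-dec (y <? x)) (allFin _))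

-- (σ∖{x} ; σ) = (-1)^(m-j), where |σ| = m+1 and x = i_j
removeSign : ∀ {n} → Subset n → Fin n → Sign
removeSign σ x = signPow ((∣ σ ∣ ∸ 1) ∸ index σ x)

sumℤ : List ℤ → ℤ
sumℤ = foldr ℤ._+_ (ℤ.+ 0)

sumℚ : List ℚ → ℚ
sumℚ = foldr ℚ._+_ 0ℚ

_≟ˢ_ : ∀ {n} (p q : Subset n) → Dec (p ≡ q)
_≟ˢ_ = ≡-dec _≟ᵇ_

-- the incidence number (τ;σ): equals (-1)^(m-j) if τ = σ∖{i_j}, and 0 otherwise
incidence : ∀ {n} → Subset n → Subset n → ℤ
incidence {n} τ σ = sumℤ (map term (allFin n))
  where
  term : Fin n → ℤ
  term x with (x ∈? σ) ×-dec (τ ≟ˢ (σ ─ ⁅ x ⁆))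
  ... | yes _ = removeSign σ x ℤ.◃ 1
  ... | no  _ = ℤ.+ 0

A : ∀ {n} → Orientation n → Subset n → Subset n → ℚ
A ε τ σ = ((ε σ ℤ.◃ 1) ℤ.* incidence τ σ) ℚ./ 1

IsFace : ∀ {n} → ℕ → Subset n → Subset n → Set
IsFace m W σ = σ ⊆ W × ∣ σ ∣ ≡ suc m

HasCycle : ∀ {n} → ℕ → Subset n → Orientation n → Set
HasCycle {n} m W ε =
  Σ (List (Subset n)) λ C → Σ (Subset n → ℚ) λ v →
    C ≢ [] × Unique C × All (IsFace m W) C × All (λ F → 0ℚ ℚ.< v F) C ×
    (∀ (τ : Subset n) → τ ⊆ W → ∣ τ ∣ ≡ m →
       sumℚ (map (λ F → v F ℚ.* A ε τ F) C) ≡ 0ℚ)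

Acyclic : ∀ {n} → ℕ → Subset n → Orientation n → Set
Acyclic m W ε = ¬ HasCycle m W ε

link : ∀ {n} → Orientation n → Fin n → Orientation n
link ε x τ = ε (τ ∪ ⁅ x ⁆) Sign.* removeSign (τ ∪ ⁅ x ⁆) x

allBut : ∀ {n} → Fin n → Subset n
allBut x = ⊤ ─ ⁅ x ⁆

above : ∀ {n} → Fin n → Subset n
above x = tabulate (λ y → does (x <? y))

-- Let C be a cycle of d-faces with weights v, and let i be the least vertex lying on a face of C.
-- Deleting i from the faces of C through i gives (d-1)-faces above i, weighted by v (G ∪ {i}).
-- For a (d-1)-face ρ avoiding i, the link entry A_lk(i) (ρ, F∖{i}) equals (-1)^d A (ρ ∪ {i}, F):
-- as i precedes the other vertices of F, removing it lowers every index by one, and the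
-- orientation of the link contributes (F∖{i} ; F) = (-1)^d. Faces of C avoiding i contribute
-- nothing at ρ ∪ {i}, so the balance of C at ρ ∪ {i} makes these faces a cycle of lk(i) on any
-- vertex set containing {i+1,…,n} but not i.

module Submission where

open import Defs
open import Level using (0ℓ)
open import Function using (_∘_; _⇔_; Equivalence; mk⇔)
open import Relation.Binary.PropositionalEquality
open import Relation.Nullary using (¬_; yes; no; contradiction; _×-dec_)
open import Relation.Nullary.Decidable using (dec-true; dec-false)
open import Relation.Unary using (Pred; Decidable)
open import Data.Product using (Σ-syntax; proj₁; proj₂; _,_; _×_)
open import Data.Sum using (inj₂)
open import Data.Bool using (true; false)
open import Data.Nat as ℕ using (ℕ; suc; _∸_; _≤_; z≤n; s≤s)
import Data.Nat.Properties as ℕ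
open import Data.Fin as Fin using (Fin; zero; suc; _<?_) renaming (_≤_ to _≤ᶠ_; _<_ to _<ᶠ_)
import Data.Fin.Properties as Fin
open import Data.Fin.Subset
open import Data.Fin.Subset.Properties
open import Data.Vec using (_∷_; here; there)
open import Data.Vec.Properties using (lookup⇒[]=; []=⇒lookup; lookup∘tabulate)
open import Data.List using (List; []; _∷_; filter; length; tabulate; allFin; map)
import Data.List.Properties as List
open import Data.List.Relation.Unary.All using (All; []; _∷_)
import Data.List.Relation.Unary.All as All
import Data.List.Relation.Unary.All.Properties as All
open import Data.List.Relation.Unary.Any using (Any; here; there)
import Data.List.Relation.Unary.Any as Any
open import Data.List.Relation.Unary.AllPairs using ([]; _∷_)
open import Data.List.Relation.Unary.Unique.Propositional using (Unique)
open import Data.Integer as ℤ using (ℤ; 0ℤ)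
import Data.Integer.Properties as ℤ
open import Data.Rational as ℚ using (ℚ; 0ℚ)
import Data.Rational.Properties as ℚ
open import Data.Sign as Sign using (Sign)
import Data.Sign.Properties as Sign
open import Algebra.Properties.Group ℚ.+-0-group using (⁻¹-involutive)

p-x∪⁅x⁆≡p : ∀ {n} (p : Subset n) {x} → x ∈ p → (p - x) ∪ ⁅ x ⁆ ≡ p
p-x∪⁅x⁆≡p (true ∷ p) here =
  cong (true ∷_) (trans (cong (_∪ ⊥) (p─⊥≡p p)) (∪-identityʳ p))
p-x∪⁅x⁆≡p (true ∷ p) (there x∈p) = cong (true ∷_) (p-x∪⁅x⁆≡p p x∈p)
p-x∪⁅x⁆≡p (false ∷ p) (there x∈p) = cong (false ∷_) (p-x∪⁅x⁆≡p p x∈p)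

p∪⁅x⁆-x≡p : ∀ {n} (p : Subset n) {x} → x ∉ p → (p ∪ ⁅ x ⁆) - x ≡ p
p∪⁅x⁆-x≡p (true ∷ p) {zero} x∉p = contradiction here x∉p
p∪⁅x⁆-x≡p (false ∷ p) {zero} _ =
  cong (false ∷_) (trans (p─⊥≡p (p ∪ ⊥)) (∪-identityʳ p))
p∪⁅x⁆-x≡p (true ∷ p) {suc x} x∉p = cong (true ∷_) (p∪⁅x⁆-x≡p p (x∉p ∘ there))
p∪⁅x⁆-x≡p (false ∷ p) {suc x} x∉p = cong (false ∷_) (p∪⁅x⁆-x≡p p (x∉p ∘ there))

∣p∣≡1+∣p-x∣ : ∀ {n} (p : Subset n) {x} → x ∈ p → ∣ p ∣ ≡ suc ∣ p - x ∣
∣p∣≡1+∣p-x∣ (true ∷ p) here = cong (suc ∘ ∣_∣) (sym (p─⊥≡p p))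
∣p∣≡1+∣p-x∣ (true ∷ p) (there x∈p) = cong suc (∣p∣≡1+∣p-x∣ p x∈p)
∣p∣≡1+∣p-x∣ (false ∷ p) (there x∈p) = ∣p∣≡1+∣p-x∣ p x∈p

x∈p-y⇒x≢y : ∀ {n} {p : Subset n} {x y} → x ∈ p - y → x ≢ y
x∈p-y⇒x≢y {p = _ ∷ p} {suc x} {suc y} (there x∈p-y) refl = x∈p-y⇒x≢y {p = p} x∈p-y refl

x∈p∪⁅x⁆ : ∀ {n} (p : Subset n) x → x ∈ p ∪ ⁅ x ⁆
x∈p∪⁅x⁆ p x = x∈p∪q⁺ (inj₂ (x∈⁅x⁆ x))

LowerBound : ∀ {n} → Fin n → Subset n → Set
LowerBound i p = ∀ {y} → y ∈ p → i ≤ᶠ y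

module _ {a p} {A : Set a} {P Q : Pred A p} (P? : Decidable P) (Q? : Decidable Q) where

  length-filter-cong : ∀ {xs} → All (λ x → P x ⇔ Q x) xs →
                       length (filter P? xs) ≡ length (filter Q? xs)
  length-filter-cong {[]} [] = refl
  length-filter-cong {x ∷ xs} (P⇔Q ∷ eqs) with P? x | Q? x
  ... | yes _  | yes _  = cong suc (length-filter-cong eqs)
  ... | no  _  | no  _  = length-filter-cong eqs
  ... | yes px | no ¬qx = contradiction (Equivalence.to P⇔Q px) ¬qx
  ... | no ¬px | yes qx = contradiction (Equivalence.from P⇔Q qx) ¬px

  length-filter-tabulate-extra : ∀ {n} (f : Fin n → A) (i : Fin n) → P (f i) → ¬ Q (f i) →
    (∀ j → j ≢ i → P (f j) ⇔ Q (f j)) →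
    length (filter P? (tabulate f)) ≡ suc (length (filter Q? (tabulate f)))
  length-filter-tabulate-extra f zero pfi ¬qfi eqs with P? (f zero) | Q? (f zero)
  ... | yes _ | no _ = cong suc (length-filter-cong (All.tabulate⁺ (λ j → eqs (suc j) λ ())))
  ... | no ¬pfi | _ = contradiction pfi ¬pfi
  ... | _ | yes qfi = contradiction qfi ¬qfi
  length-filter-tabulate-extra f (suc i) pfi ¬qfi eqs
    with P? (f zero) | Q? (f zero)
       | length-filter-tabulate-extra (f ∘ suc) i pfi ¬qfi (λ j j≢i → eqs (suc j) (j≢i ∘ Fin.suc-injective))
  ... | yes _  | yes _  | ih = cong suc ih
  ... | no  _  | no  _  | ih = ih
  ... | yes p0 | no ¬q0 | _  = contradiction (Equivalence.to (eqs zero λ ()) p0) ¬q0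
  ... | no ¬p0 | yes q0 | _  = contradiction (Equivalence.from (eqs zero λ ()) q0) ¬p0

module _ {n} {F : Subset n} {i : Fin n} (i∈F : i ∈ F) (i≤F : LowerBound i F) where

  index-least : index F i ≡ 0
  index-least = cong length (List.filter-none _ (All.tabulate⁺ below-none))
    where
    below-none : ∀ y → ¬ (y ∈ F × y <ᶠ i)
    below-none y (y∈F , y<i) = ℕ.<⇒≱ y<i (i≤F y∈F)

  index-remove-least : ∀ {x} → i <ᶠ x → index F x ≡ suc (index (F - i) x)
  index-remove-least {x} i<x = length-filter-tabulate-extra _ _ _ i (i∈F , i<x) i∉F-i agree
    where
    i∉F-i : ¬ (i ∈ F - i × i <ᶠ x)
    i∉F-i (i∈F-i , _) = x∈p-y⇒x≢y i∈F-i refl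
    agree : ∀ y → y ≢ i → (y ∈ F × y <ᶠ x) ⇔ (y ∈ F - i × y <ᶠ x)
    agree y y≢i = mk⇔ (λ (y∈F , y<x) → x∈p∧x≢y⇒x∈p-y y∈F y≢i , y<x)
                      (λ (y∈F-i , y<x) → p─q⊆p F ⁅ i ⁆ y∈F-i , y<x)

  removeSign-remove-least : ∀ {x} → x ∈ F - i → removeSign F x ≡ removeSign (F - i) x
  removeSign-remove-least {x} x∈F-i = cong signPow (begin
      (∣ F ∣ ∸ 1) ∸ index F x
    ≡⟨ cong₂ (λ a b → (a ∸ 1) ∸ b) (∣p∣≡1+∣p-x∣ F i∈F) (index-remove-least i<x) ⟩
      ∣ F - i ∣ ∸ suc (index (F - i) x)
    ≡⟨ ℕ.∸-+-assoc ∣ F - i ∣ 1 (index (F - i) x) ⟨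
      (∣ F - i ∣ ∸ 1) ∸ index (F - i) x ∎)
    where
    open ≡-Reasoning
    i<x : i <ᶠ x
    i<x = Fin.≤∧≢⇒< (i≤F (p─q⊆p F ⁅ i ⁆ x∈F-i)) (λ i≡x → x∈p-y⇒x≢y x∈F-i (sym i≡x))

  removeSign-least : removeSign F i ≡ signPow (∣ F ∣ ∸ 1)
  removeSign-least = cong (λ k → signPow ((∣ F ∣ ∸ 1) ∸ k)) index-least

-- The summand of incidence is local to its where-block in Defs; unification recovers it.
incidenceSummand : ∀ {n} (τ σ : Subset n) →
  Σ[ t ∈ (Fin n → ℤ) ] incidence τ σ ≡ sumℤ (map t (allFin n))
incidenceSummand τ σ = _ , refl

incidenceTerm : ∀ {n} → Subset n → Subset n → Fin n → ℤ
incidenceTerm τ σ = proj₁ (incidenceSummand τ σ)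

sumℤ-zero : ∀ {A : Set} (f : A → ℤ) → (∀ x → f x ≡ 0ℤ) → ∀ xs → sumℤ (map f xs) ≡ 0ℤ
sumℤ-zero f f≡0 [] = refl
sumℤ-zero f f≡0 (x ∷ xs) = cong₂ ℤ._+_ (f≡0 x) (sumℤ-zero f f≡0 xs)

incidence-avoiding : ∀ {n} {τ F : Subset n} {i} → i ∈ τ → i ∉ F → incidence τ F ≡ 0ℤ
incidence-avoiding {n} {τ} {F} {i} i∈τ i∉F = sumℤ-zero (incidenceTerm τ F) term≡0 (allFin n)
  where
  term≡0 : ∀ x → incidenceTerm τ F x ≡ 0ℤ
  term≡0 x with (x ∈? F) ×-dec (τ ≟ˢ (F - x))
  ... | yes (_ , refl) = contradiction (p─q⊆p F ⁅ x ⁆ i∈τ) i∉F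
  ... | no _ = refl

incidence-link : ∀ {n} {F : Subset n} {i} → i ∈ F → LowerBound i F → ∀ {ρ} → i ∉ ρ →
  incidence (ρ ∪ ⁅ i ⁆) F ≡ incidence ρ (F - i)
incidence-link {n} {F} {i} i∈F i≤F {ρ} i∉ρ = cong sumℤ (List.map-cong same-term (allFin n))
  where
  same-term : ∀ x → incidenceTerm (ρ ∪ ⁅ i ⁆) F x ≡ incidenceTerm ρ (F - i) x
  same-term x with (x ∈? F) ×-dec ((ρ ∪ ⁅ i ⁆) ≟ˢ (F - x)) | (x ∈? F - i) ×-dec (ρ ≟ˢ (F - i - x))
  ... | yes _ | yes (x∈F-i , _) = cong (ℤ._◃ 1) (removeSign-remove-least i∈F i≤F x∈F-i)
  ... | no _ | no _ = refl
  ... | yes (x∈F , ρ∪i≡F-x) | no ¬side = contradiction (x∈F-i , ρ≡F-i-x) ¬side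
    where
    x≢i : x ≢ i
    x≢i refl = x∈p-y⇒x≢y (subst (i ∈_) ρ∪i≡F-x (x∈p∪⁅x⁆ ρ i)) refl
    x∈F-i : x ∈ F - i
    x∈F-i = x∈p∧x≢y⇒x∈p-y x∈F x≢i
    ρ≡F-i-x : ρ ≡ F - i - x
    ρ≡F-i-x = trans (sym (p∪⁅x⁆-x≡p ρ i∉ρ)) (trans (cong (_- i) ρ∪i≡F-x) (p─x─y≡p─y─x F x i))
  ... | no ¬side | yes (x∈F-i , ρ≡F-i-x) = contradiction (x∈F , ρ∪i≡F-x) ¬side
    where
    x∈F : x ∈ F
    x∈F = p─q⊆p F ⁅ i ⁆ x∈F-i
    i∈F-x : i ∈ F - x
    i∈F-x = x∈p∧x≢y⇒x∈p-y i∈F (λ i≡x → x∈p-y⇒x≢y x∈F-i (sym i≡x))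
    ρ∪i≡F-x : ρ ∪ ⁅ i ⁆ ≡ F - x
    ρ∪i≡F-x = trans (cong (_∪ ⁅ i ⁆) (trans ρ≡F-i-x (p─x─y≡p─y─x F i x))) (p-x∪⁅x⁆≡p (F - x) i∈F-x)

signed : Sign → ℚ → ℚ
signed Sign.+ q = q
signed Sign.- q = ℚ.- q

signed-0 : ∀ s → signed s 0ℚ ≡ 0ℚ
signed-0 Sign.+ = refl
signed-0 Sign.- = refl

signed-+ : ∀ s p q → signed s (p ℚ.+ q) ≡ signed s p ℚ.+ signed s q
signed-+ Sign.+ p q = refl
signed-+ Sign.- p q = ℚ.neg-distrib-+ p q

*-signed : ∀ s p q → p ℚ.* signed s q ≡ signed s (p ℚ.* q)
*-signed Sign.+ p q = refl
*-signed Sign.- p q = sym (ℚ.neg-distribʳ-* p q)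

neg-/1 : ∀ z → (ℤ.- z) ℚ./ 1 ≡ ℚ.- (z ℚ./ 1)
neg-/1 (ℤ.+ 0) = refl
neg-/1 ℤ.+[1+ n ] = refl
neg-/1 ℤ.-[1+ n ] = sym (⁻¹-involutive _)

◃-opposite : ∀ s → (Sign.opposite s ℤ.◃ 1) ≡ ℤ.- (s ℤ.◃ 1)
◃-opposite Sign.+ = refl
◃-opposite Sign.- = refl

*-sign-/1 : ∀ e s z → (((e Sign.* s) ℤ.◃ 1) ℤ.* z) ℚ./ 1 ≡ signed s (((e ℤ.◃ 1) ℤ.* z) ℚ./ 1)
*-sign-/1 e Sign.+ z = cong (λ t → ((t ℤ.◃ 1) ℤ.* z) ℚ./ 1) (Sign.*-identityʳ e)
*-sign-/1 e Sign.- z = begin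
    (((e Sign.* Sign.-) ℤ.◃ 1) ℤ.* z) ℚ./ 1
  ≡⟨ cong (λ t → ((t ℤ.◃ 1) ℤ.* z) ℚ./ 1) (Sign.*-comm e Sign.-) ⟩
    ((Sign.opposite e ℤ.◃ 1) ℤ.* z) ℚ./ 1
  ≡⟨ cong (λ t → (t ℤ.* z) ℚ./ 1) (◃-opposite e) ⟩
    (ℤ.- (e ℤ.◃ 1) ℤ.* z) ℚ./ 1
  ≡⟨ cong (ℚ._/ 1) (ℤ.neg-distribˡ-* (e ℤ.◃ 1) z) ⟨
    (ℤ.- ((e ℤ.◃ 1) ℤ.* z)) ℚ./ 1
  ≡⟨ neg-/1 ((e ℤ.◃ 1) ℤ.* z) ⟩
    ℚ.- (((e ℤ.◃ 1) ℤ.* z) ℚ./ 1) ∎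
  where open ≡-Reasoning

A-avoiding : ∀ {n} (ε : Orientation n) {τ F : Subset n} {i} → i ∈ τ → i ∉ F → A ε τ F ≡ 0ℚ
A-avoiding ε {F = F} i∈τ i∉F =
  cong (ℚ._/ 1) (trans (cong ((ε F ℤ.◃ 1) ℤ.*_) (incidence-avoiding i∈τ i∉F)) (ℤ.*-zeroʳ (ε F ℤ.◃ 1)))

A-link : ∀ {n} (ε : Orientation n) {d} {F : Subset n} {i} → i ∈ F → LowerBound i F → ∣ F ∣ ≡ suc d →
  ∀ {ρ} → i ∉ ρ → A (link ε i) ρ (F - i) ≡ signed (signPow d) (A ε (ρ ∪ ⁅ i ⁆) F)
A-link ε {d} {F} {i} i∈F i≤F ∣F∣≡1+d {ρ} i∉ρ = begin
    A (link ε i) ρ (F - i)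
  ≡⟨ cong (λ G → (((ε G Sign.* removeSign G i) ℤ.◃ 1) ℤ.* incidence ρ (F - i)) ℚ./ 1)
          (p-x∪⁅x⁆≡p F i∈F) ⟩
    (((ε F Sign.* removeSign F i) ℤ.◃ 1) ℤ.* incidence ρ (F - i)) ℚ./ 1
  ≡⟨ cong₂ (λ s z → (((ε F Sign.* s) ℤ.◃ 1) ℤ.* z) ℚ./ 1)
           (trans (removeSign-least i∈F i≤F) (cong (λ k → signPow (k ∸ 1)) ∣F∣≡1+d))
           (sym (incidence-link i∈F i≤F i∉ρ)) ⟩
    (((ε F Sign.* signPow d) ℤ.◃ 1) ℤ.* incidence (ρ ∪ ⁅ i ⁆) F) ℚ./ 1
  ≡⟨ *-sign-/1 (ε F) (signPow d) (incidence (ρ ∪ ⁅ i ⁆) F) ⟩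
    signed (signPow d) (A ε (ρ ∪ ⁅ i ⁆) F) ∎
  where open ≡-Reasoning

module _ {n} (i : Fin n) where

  linkFaces : List (Subset n) → List (Subset n)
  linkFaces C = map (_- i) (filter (i ∈?_) C)

  All-linkFaces : ∀ {P Q : Subset n → Set} {C} → (∀ {F} → i ∈ F → P F → Q (F - i)) →
                  All P C → All Q (linkFaces C)
  All-linkFaces {C = []} f [] = []
  All-linkFaces {C = F ∷ C} f (pF ∷ pC) with i ∈? F
  ... | yes i∈F = f i∈F pF ∷ All-linkFaces f pC
  ... | no _    = All-linkFaces f pC

  linkFaces≢[] : ∀ {C} → Any (i ∈_) C → linkFaces C ≢ []
  linkFaces≢[] {F ∷ C} i∈C with i ∈? F | i∈C
  ... | yes _   | _          = λ ()
  ... | no i∉F  | here i∈F   = contradiction i∈F i∉F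
  ... | no _    | there i∈C′ = linkFaces≢[] i∈C′

  Unique-linkFaces : ∀ {C} → Unique C → Unique (linkFaces C)
  Unique-linkFaces {[]} [] = []
  Unique-linkFaces {F ∷ C} (F∉C ∷ uC) with i ∈? F
  ... | yes i∈F = All-linkFaces (λ i∈F′ F≢F′ F-i≡F′-i → F≢F′ (remove-injective i∈F i∈F′ F-i≡F′-i)) F∉C
                  ∷ Unique-linkFaces uC
    where
    remove-injective : ∀ {F F′} → i ∈ F → i ∈ F′ → F - i ≡ F′ - i → F ≡ F′
    remove-injective {F} {F′} i∈F i∈F′ eq =
      trans (sym (p-x∪⁅x⁆≡p F i∈F)) (trans (cong (_∪ ⁅ i ⁆) eq) (p-x∪⁅x⁆≡p F′ i∈F′))
  ... | no _ = Unique-linkFaces uC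

  sum-linkFaces : ∀ (ε : Orientation n) d (v : Subset n → ℚ) {ρ} → i ∉ ρ →
    ∀ {C} → All (λ F → ∣ F ∣ ≡ suc d × LowerBound i F) C →
    sumℚ (map (λ G → v (G ∪ ⁅ i ⁆) ℚ.* A (link ε i) ρ G) (linkFaces C))
      ≡ signed (signPow d) (sumℚ (map (λ F → v F ℚ.* A ε (ρ ∪ ⁅ i ⁆) F) C))
  sum-linkFaces ε d v i∉ρ {[]} [] = sym (signed-0 (signPow d))
  sum-linkFaces ε d v {ρ} i∉ρ {F ∷ C} ((∣F∣≡1+d , i≤F) ∷ hC) with i ∈? F
  ... | yes i∈F = begin
      v ((F - i) ∪ ⁅ i ⁆) ℚ.* A (link ε i) ρ (F - i) ℚ.+ S′
    ≡⟨ cong₂ ℚ._+_ (cong₂ ℚ._*_ (cong v (p-x∪⁅x⁆≡p F i∈F)) (A-link ε i∈F i≤F ∣F∣≡1+d i∉ρ))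
                   (sum-linkFaces ε d v i∉ρ hC) ⟩
      v F ℚ.* signed s (A ε (ρ ∪ ⁅ i ⁆) F) ℚ.+ signed s S
    ≡⟨ cong (ℚ._+ signed s S) (*-signed s (v F) _) ⟩
      signed s (v F ℚ.* A ε (ρ ∪ ⁅ i ⁆) F) ℚ.+ signed s S
    ≡⟨ signed-+ s _ S ⟨
      signed s (v F ℚ.* A ε (ρ ∪ ⁅ i ⁆) F ℚ.+ S) ∎
    where
    open ≡-Reasoning
    s : Sign
    s = signPow d
    S : ℚ
    S = sumℚ (map (λ F → v F ℚ.* A ε (ρ ∪ ⁅ i ⁆) F) C)
    S′ : ℚ
    S′ = sumℚ (map (λ G → v (G ∪ ⁅ i ⁆) ℚ.* A (link ε i) ρ G) (linkFaces C))
  ... | no i∉F = begin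
      S′
    ≡⟨ sum-linkFaces ε d v i∉ρ hC ⟩
      signed (signPow d) S
    ≡⟨ cong (signed (signPow d)) F-vanishes ⟨
      signed (signPow d) (v F ℚ.* A ε (ρ ∪ ⁅ i ⁆) F ℚ.+ S) ∎
    where
    open ≡-Reasoning
    S : ℚ
    S = sumℚ (map (λ F → v F ℚ.* A ε (ρ ∪ ⁅ i ⁆) F) C)
    S′ : ℚ
    S′ = sumℚ (map (λ G → v (G ∪ ⁅ i ⁆) ℚ.* A (link ε i) ρ G) (linkFaces C))
    F-vanishes : v F ℚ.* A ε (ρ ∪ ⁅ i ⁆) F ℚ.+ S ≡ S
    F-vanishes = begin
        v F ℚ.* A ε (ρ ∪ ⁅ i ⁆) F ℚ.+ S ≡⟨ cong (λ a → v F ℚ.* a ℚ.+ S) (A-avoiding ε (x∈p∪⁅x⁆ ρ i) i∉F) ⟩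
        v F ℚ.* 0ℚ ℚ.+ S                ≡⟨ cong (ℚ._+ S) (ℚ.*-zeroʳ (v F)) ⟩
        0ℚ ℚ.+ S                        ≡⟨ ℚ.+-identityˡ S ⟩
        S                               ∎

least : ∀ {n} {P : Pred (Fin n) 0ℓ} → Decidable P → ∀ {x} → P x →
        Σ[ i ∈ Fin n ] P i × (∀ {y} → P y → i ≤ᶠ y)
least {suc n} P? {x} px with P? zero | x
... | yes p0 | _     = zero , p0 , λ _ → z≤n
... | no ¬p0 | zero  = contradiction px ¬p0
... | no ¬p0 | suc x with least (P? ∘ suc) px
...   | i , pi , i-least = suc i , pi , λ { {zero} p0 → contradiction p0 ¬p0 ; {suc y} py → s≤s (i-least py) }

nonempty-of-size : ∀ {n} (p : Subset n) {k} → ∣ p ∣ ≡ suc k → Nonempty p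
nonempty-of-size (true ∷ p) _ = zero , here
nonempty-of-size (false ∷ p) ∣p∣≡1+k with nonempty-of-size p ∣p∣≡1+k
... | x , x∈p = suc x , there x∈p

HasCycle⇒link-HasCycle : ∀ {n} d (ε : Orientation n) (W : Fin n → Subset n) →
  (∀ {i y} → i <ᶠ y → y ∈ W i) → (∀ i → i ∉ W i) →
  HasCycle (suc d) ⊤ ε → Σ[ i ∈ Fin n ] HasCycle d (W i) (link ε i)
HasCycle⇒link-HasCycle d ε W above⊆W i∉W ([] , _ , C≢[] , _) = contradiction refl C≢[]
HasCycle⇒link-HasCycle {n} d ε W above⊆W i∉W
  (C@(F₀ ∷ _) , v , _ , unique , faces@((_ , ∣F₀∣≡d+2) ∷ _) , positive , balanced) =
  i , linkFaces i C , (λ G → v (G ∪ ⁅ i ⁆)) , linkFaces≢[] i i∈C , Unique-linkFaces i unique ,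
  All-linkFaces i link-face (All.zip (sizes , bounds)) ,
  All-linkFaces i (λ {F} i∈F → subst (λ H → 0ℚ ℚ.< v H) (sym (p-x∪⁅x⁆≡p F i∈F))) positive ,
  link-balanced
  where
  least-vertex : Σ[ i ∈ Fin n ] Any (i ∈_) C × (∀ {y} → Any (y ∈_) C → i ≤ᶠ y)
  least-vertex = least (λ y → Any.any? (y ∈?_) C) (here (proj₂ (nonempty-of-size F₀ ∣F₀∣≡d+2)))
  i : Fin n
  i = proj₁ least-vertex
  i∈C : Any (i ∈_) C
  i∈C = proj₁ (proj₂ least-vertex)
  sizes : All (λ F → ∣ F ∣ ≡ suc (suc d)) C
  sizes = All.map proj₂ faces
  bounds : All (LowerBound i) C
  bounds = All.tabulate λ F∈C y∈F → proj₂ (proj₂ least-vertex) (Any.map (λ { refl → y∈F }) F∈C)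
  link-face : ∀ {F} → i ∈ F → ∣ F ∣ ≡ suc (suc d) × LowerBound i F → IsFace d (W i) (F - i)
  link-face {F} i∈F (∣F∣≡d+2 , i≤F) =
    (λ y∈F-i → above⊆W (Fin.≤∧≢⇒< (i≤F (p─q⊆p F ⁅ i ⁆ y∈F-i)) (λ i≡y → x∈p-y⇒x≢y y∈F-i (sym i≡y)))) ,
    ℕ.suc-injective (trans (sym (∣p∣≡1+∣p-x∣ F i∈F)) ∣F∣≡d+2)
  link-balanced : ∀ ρ → ρ ⊆ W i → ∣ ρ ∣ ≡ d →
    sumℚ (map (λ G → v (G ∪ ⁅ i ⁆) ℚ.* A (link ε i) ρ G) (linkFaces i C)) ≡ 0ℚ
  link-balanced ρ ρ⊆Wi ∣ρ∣≡d = begin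
      sumℚ (map (λ G → v (G ∪ ⁅ i ⁆) ℚ.* A (link ε i) ρ G) (linkFaces i C))
    ≡⟨ sum-linkFaces i ε (suc d) v i∉ρ (All.zip (sizes , bounds)) ⟩
      signed (signPow (suc d)) (sumℚ (map (λ F → v F ℚ.* A ε (ρ ∪ ⁅ i ⁆) F) C))
    ≡⟨ cong (signed (signPow (suc d))) (balanced (ρ ∪ ⁅ i ⁆) ⊆⊤ ∣ρ∪i∣≡d+1) ⟩
      signed (signPow (suc d)) 0ℚ
    ≡⟨ signed-0 (signPow (suc d)) ⟩
      0ℚ ∎
    where
    open ≡-Reasoning
    i∉ρ : i ∉ ρ
    i∉ρ = i∉W i ∘ ρ⊆Wi
    ∣ρ∪i∣≡d+1 : ∣ ρ ∪ ⁅ i ⁆ ∣ ≡ suc d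
    ∣ρ∪i∣≡d+1 = trans (∣p∣≡1+∣p-x∣ (ρ ∪ ⁅ i ⁆) (x∈p∪⁅x⁆ ρ i)) (cong suc (trans (cong ∣_∣ (p∪⁅x⁆-x≡p ρ i∉ρ)) ∣ρ∣≡d))

acyclic-if-links-acyclic : ∀ {n} d (ε : Orientation n) (W : Fin n → Subset n) →
  (∀ {i y} → i <ᶠ y → y ∈ W i) → (∀ i → i ∉ W i) →
  (∀ i → Acyclic d (W i) (link ε i)) → Acyclic (suc d) ⊤ ε
acyclic-if-links-acyclic d ε W above⊆W i∉W acyclic-links cycle
  with i , link-cycle ← HasCycle⇒link-HasCycle d ε W above⊆W i∉W cycle = acyclic-links i link-cycle

<⇒∈allBut : ∀ {n} {i y : Fin n} → i <ᶠ y → y ∈ allBut i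
<⇒∈allBut i<y = x∈p∧x≢y⇒x∈p-y ∈⊤ (Fin.<⇒≢ i<y ∘ sym)

∉allBut : ∀ {n} (i : Fin n) → i ∉ allBut i
∉allBut i i∈allBut = x∈p-y⇒x≢y i∈allBut refl

<⇒∈above : ∀ {n} {i y : Fin n} → i <ᶠ y → y ∈ above i
<⇒∈above {i = i} {y} i<y =
  lookup⇒[]= y (above i) (trans (lookup∘tabulate _ y) (dec-true (i <? y) i<y))

∉above : ∀ {n} (i : Fin n) → i ∉ above i
∉above i i∈above = contradiction
  (trans (sym ([]=⇒lookup i∈above)) (trans (lookup∘tabulate _ i) (dec-false (i <? i) (Fin.<-irrefl refl))))
  λ ()

mainTheorem2 : (d : ℕ) → 1 ≤ d → (n : ℕ) → (ε : Orientation n) →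
    ((∀ (i : Fin n) → Acyclic (d ∸ 1) (allBut i) (link ε i)) → Acyclic d ⊤ ε)
    × ((∀ (i : Fin n) → Acyclic (d ∸ 1) (above i) (link ε i)) → Acyclic d ⊤ ε)
mainTheorem2 (suc d) (s≤s z≤n) n ε =
  acyclic-if-links-acyclic d ε allBut <⇒∈allBut ∉allBut ,
  acyclic-if-links-acyclic d ε above <⇒∈above ∉above
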